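{- Let $\mathsf{G}$ be a complete convex geometric graph of order $n$. Then: (i) every two halving edges of $\mathsf{G}$ intersect; (ii) every halving edge intersects every halving pair; (iii) every two halving pairs intersect.
   Context: A complete convex geometric graph of order $n$ is the complete geometric graph (all straight-line segments) on $n$ points in convex position; its vertices are labeled $1,\dots,n$ in clockwise order and all index arithmetic is modulo $n$. $e_{i,j}$ denotes the edge between vertices $i$ and $j$. Two edges intersect if they share an endpoint or cross; otherwise they are disjoint. An edge $e_{i,j}$ is a halving edge if each of the two open half-planes bounded by the line through $e_{i,j}$ contains at least $\lfloor \frac{n-2}{2}\rfloor$ vertices of $\mathsf{G}$. For $i,j,k\in\{1,\dots,n\}$ such that $e_{i,j}$ and $e_{j+1,k}$ do not intersect, the pair $(e_{i,j},e_{j+1,k})$ is a halving pair if at least one of $e_{i,j+1}$, $e_{i,k}$, $e_{j,k}$ is a halving edge. An edge intersects a pair of edges if it intersects at least one edge of the pair; two pairs intersect if some edge of the first pair intersects the second pair. -}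

module Defs where

open import Data.Nat using (ℕ; suc; _<_; _≤_; _∸_)
open import Data.Nat.Properties using (_<?_)
open import Data.Nat.DivMod using (_/_; _mod_)
open import Data.Fin using (Fin; toℕ)
open import Data.List using (List; length; filter)
open import Data.List using () renaming (allFin to allFinL)
open import Data.Product using (_×_)
open import Data.Sum using (_⊎_)
open import Relation.Nullary using (Dec; ¬_)
open import Relation.Nullary.Decidable using (_×-dec_; _⊎-dec_)
open import Relation.Binary.PropositionalEquality using (_≡_; _≢_)

-- Vertices of the complete convex geometric graph of order n are Fin n,
-- i.e. labels 0,…,n-1 (label k here = label k+1 in the paper), in
-- clockwise order; index arithmetic is modulo n.

sucMod : ∀ {n} → Fin n → Fin n
sucMod {suc m} i = suc (toℕ i) mod suc m

-- Between a x b : vertex x lies strictly inside the clockwise arc from a to b.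
-- Geometrically: x lies in the open half-plane on that side of the line
-- through a and b (points in convex position).
Between : ∀ {n} → Fin n → Fin n → Fin n → Set
Between a x b =
  (toℕ a < toℕ x × toℕ x < toℕ b) ⊎ (toℕ b < toℕ a × (toℕ a < toℕ x ⊎ toℕ x < toℕ b))

between? : ∀ {n} (a x b : Fin n) → Dec (Between a x b)
between? a x b =
  ((toℕ a <? toℕ x) ×-dec (toℕ x <? toℕ b))
  ⊎-dec ((toℕ b <? toℕ a) ×-dec ((toℕ a <? toℕ x) ⊎-dec (toℕ x <? toℕ b)))

arcSize : ∀ {n} → Fin n → Fin n → ℕ
arcSize {n} a b = length (filter (λ x → between? a x b) (allFinL n))

IsHalving : ∀ {n} → Fin n → Fin n → Set
IsHalving {n} a b = ((n ∸ 2) / 2 ≤ arcSize a b) × ((n ∸ 2) / 2 ≤ arcSize b a)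

-- e_{a,b} and e_{c,d} cross (in convex position: endpoints of one edge lie
-- on both sides of the other).
Cross : ∀ {n} → Fin n → Fin n → Fin n → Fin n → Set
Cross a b c d = (Between a c b × Between b d a) ⊎ (Between b c a × Between a d b)

Intersect : ∀ {n} → Fin n → Fin n → Fin n → Fin n → Set
Intersect a b c d =
  (a ≡ c ⊎ a ≡ d ⊎ b ≡ c ⊎ b ≡ d) ⊎ Cross a b c d

record Edge (n : ℕ) : Set where
  constructor edge
  field
    src tgt  : Fin n
    distinct : src ≢ tgt
open Edge public

HalvingEdge : ∀ {n} → Edge n → Set
HalvingEdge e = IsHalving (src e) (tgt e)

EdgesIntersect : ∀ {n} → Edge n → Edge n → Set
EdgesIntersect e f = Intersect (src e) (tgt e) (src f) (tgt f)

record HalvingPair (n : ℕ) : Set where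
  field
    i j k    : Fin n
    i≢j      : i ≢ j
    j+1≢k    : sucMod j ≢ k
    disjoint : ¬ Intersect i j (sucMod j) k
    halving  : IsHalving i (sucMod j) ⊎ IsHalving i k ⊎ IsHalving j k
open HalvingPair public

firstEdge : ∀ {n} → HalvingPair n → Edge n
firstEdge p = edge (i p) (j p) (i≢j p)

secondEdge : ∀ {n} → HalvingPair n → Edge n
secondEdge p = edge (sucMod (j p)) (k p) (j+1≢k p)

EdgeMeetsPair : ∀ {n} → Edge n → HalvingPair n → Set
EdgeMeetsPair e p = EdgesIntersect e (firstEdge p) ⊎ EdgesIntersect e (secondEdge p)

PairsIntersect : ∀ {n} → HalvingPair n → HalvingPair n → Set
PairsIntersect p q = EdgeMeetsPair (firstEdge p) q ⊎ EdgeMeetsPair (secondEdge p) q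

-- If two halving edges a b and c d were disjoint, c and d would lie on one side of a b, say with
-- a c d b in cyclic order; then the closed arcs [c, d] and [b, a] are disjoint, yet each contains at
-- least ⌊(n-2)/2⌋ + 2 vertices, more than n in total. A halving pair (e_{i,j}, e_{j+1,k}) spans a
-- halving edge g among e_{i,j+1}, e_{i,k}, e_{j,k}: an edge missing both edges of the pair has
-- i, j, j+1, k on one side (j and j+1 are adjacent), so it misses g as well. Hence (ii) follows from
-- (i), and (iii) from (ii) applied to the halving edge spanned by the second pair.
module Submission where

open import Defs
open import Level using (0ℓ)
open import Data.Nat using (ℕ; suc; _+_; _*_; _∸_; _/_; _%_; _<_; _≤_)
open import Data.Nat.Properties
open import Data.Nat.DivMod using (m≡m%n+[m/n]*n; m%n<n; m<n⇒m%n≡m; n%n≡0)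
open import Data.Nat.Tactic.RingSolver using (solve-∀)
open import Data.Fin using (Fin; toℕ)
open import Data.Fin.Properties using (toℕ-injective; toℕ-fromℕ<; toℕ<n) renaming (_≟_ to _≟ᶠ_)
open import Data.List using ([]; _∷_; length; filter; allFin)
open import Data.List.Properties using (length-filter; filter-accept; filter-reject; filter-none; length-tabulate)
import Data.List.Relation.Unary.All as All
open import Data.List.Relation.Unary.Any using (here; there)
open import Data.List.Relation.Unary.Unique.Propositional using (Unique; _∷_)
open import Data.List.Relation.Unary.Unique.Propositional.Properties using (allFin⁺)
open import Data.List.Membership.Propositional using (_∈_)
open import Data.List.Membership.Propositional.Properties using (∈-allFin)
open import Data.Product using (_×_; _,_)
open import Data.Sum using (_⊎_; inj₁; inj₂)
import Data.Sum as Sum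
open import Data.Empty using (⊥; ⊥-elim)
open import Function using (_∘_; id)
open import Relation.Binary.Definitions using (DecidableEquality; tri<; tri≈; tri>)
open import Relation.Nullary using (¬_; Dec; yes; no)
open import Relation.Nullary.Decidable using (_×-dec_; _⊎-dec_)
open import Relation.Unary using (Pred; Decidable)
open import Relation.Unary.Properties using (_∪?_)
open import Relation.Binary.PropositionalEquality using (_≡_; _≢_; refl; sym; trans; cong; cong₂; subst; ≢-sym; module ≡-Reasoning)

module _ {A : Set} {P Q : Pred A 0ℓ} (P? : Decidable P) (Q? : Decidable Q) (P⊥Q : ∀ {x} → P x → ¬ Q x) where

  length-filter-∪ : ∀ xs →
    length (filter (P? ∪? Q?) xs) ≡ length (filter P? xs) + length (filter Q? xs)
  length-filter-∪ [] = refl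
  length-filter-∪ (x ∷ xs) with P? x | Q? x
  ... | yes px | yes qx = ⊥-elim (P⊥Q px qx)
  ... | yes _  | no _   = cong suc (length-filter-∪ xs)
  ... | no _   | yes _  = trans (cong suc (length-filter-∪ xs)) (sym (+-suc _ _))
  ... | no _   | no _   = length-filter-∪ xs

  length-filter-disjoint : ∀ xs → length (filter P? xs) + length (filter Q? xs) ≤ length xs
  length-filter-disjoint xs =
    subst (_≤ length xs) (length-filter-∪ xs) (length-filter (P? ∪? Q?) xs)

module _ {A : Set} (_≟_ : DecidableEquality A) where

  length-filter-≟ : ∀ {a xs} → Unique xs → a ∈ xs → length (filter (_≟ a) xs) ≡ 1
  length-filter-≟ {xs = x ∷ xs} (x∉xs ∷ _) (here refl) = begin
    length (filter (_≟ x) (x ∷ xs)) ≡⟨ cong length (filter-accept (_≟ x) refl) ⟩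
    suc (length (filter (_≟ x) xs)) ≡⟨ cong (suc ∘ length) (filter-none (_≟ x) (All.map ≢-sym x∉xs)) ⟩
    1                                ∎
    where open ≡-Reasoning
  length-filter-≟ {a} {x ∷ xs} (x∉xs ∷ u) (there a∈xs) = begin
    length (filter (_≟ a) (x ∷ xs)) ≡⟨ cong length (filter-reject (_≟ a) (All.lookup x∉xs a∈xs)) ⟩
    length (filter (_≟ a) xs)       ≡⟨ length-filter-≟ u a∈xs ⟩
    1                                ∎
    where open ≡-Reasoning

halving-threshold : ∀ n → n < (2 + (n ∸ 2) / 2) + (2 + (n ∸ 2) / 2)
halving-threshold n = begin-strict
  n                      ≤⟨ m≤n+m∸n n 2 ⟩
  2 + (n ∸ 2)            ≡⟨ cong (2 +_) (m≡m%n+[m/n]*n (n ∸ 2) 2) ⟩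
  2 + ((n ∸ 2) % 2 + t * 2) <⟨ +-monoʳ-< 2 (+-monoˡ-< (t * 2) (m%n<n (n ∸ 2) 2)) ⟩
  2 + (2 + t * 2)        ≡⟨ rearrange t ⟩
  (2 + t) + (2 + t)      ∎
  where
  open ≤-Reasoning
  t : ℕ
  t = (n ∸ 2) / 2
  rearrange : ∀ t → 2 + (2 + t * 2) ≡ (2 + t) + (2 + t)
  rearrange = solve-∀

toℕ-sucMod : ∀ {n} (j : Fin n) →
  toℕ (sucMod j) ≡ suc (toℕ j) ⊎ (toℕ (sucMod j) ≡ 0 × suc (toℕ j) ≡ n)
toℕ-sucMod {suc m} j with suc (toℕ j) <? suc m
... | yes j+1<n = inj₁ (trans (toℕ-fromℕ< _) (m<n⇒m%n≡m j+1<n))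
... | no j+1≮n  = inj₂ (trans (toℕ-fromℕ< _) (trans (cong (_% suc m) j+1≡n) (n%n≡0 (suc m))) , j+1≡n)
  where
  j+1≡n : suc (toℕ j) ≡ suc m
  j+1≡n = ≤-antisym (toℕ<n j) (≮⇒≥ j+1≮n)

sucMod-adjacent : ∀ {n} (j x : Fin n) → ¬ Between j x (sucMod j)
sucMod-adjacent j x between with toℕ-sucMod j | between
... | inj₁ eq | inj₁ (j<x , x<j+1) = <⇒≱ j<x (≤-pred (subst (toℕ x <_) eq x<j+1))
... | inj₁ eq | inj₂ (j+1<j , _)   = <-asym (subst (_< toℕ j) eq j+1<j) (n<1+n (toℕ j))
... | inj₂ (eq , _) | inj₁ (_ , x<0)      = n≮0 (subst (toℕ x <_) eq x<0)
... | inj₂ (eq , _) | inj₂ (_ , inj₂ x<0) = n≮0 (subst (toℕ x <_) eq x<0)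
... | inj₂ (_ , j+1≡n) | inj₂ (_ , inj₁ j<x) = <⇒≱ (subst (toℕ x <_) (sym j+1≡n) (toℕ<n x)) j<x

module _ {n : ℕ} where

  Between-rotate : ∀ {a x b : Fin n} → Between a x b → Between x b a
  Between-rotate (inj₁ (a<x , x<b))        = inj₂ (a<x , inj₁ x<b)
  Between-rotate (inj₂ (b<a , inj₁ a<x))   = inj₂ (a<x , inj₂ b<a)
  Between-rotate (inj₂ (b<a , inj₂ x<b))   = inj₁ (x<b , b<a)

  Between-rotate⁻¹ : ∀ {a x b : Fin n} → Between a x b → Between b a x
  Between-rotate⁻¹ = Between-rotate ∘ Between-rotate

  Between-asym : ∀ {a x b : Fin n} → Between a x b → ¬ Between b x a
  Between-asym (inj₁ (a<x , _))  (inj₁ (_ , x<a))        = <-asym a<x x<a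
  Between-asym (inj₁ (_ , x<b))  (inj₂ (_ , inj₁ b<x))   = <-asym x<b b<x
  Between-asym (inj₁ (a<x , _))  (inj₂ (_ , inj₂ x<a))   = <-asym a<x x<a
  Between-asym (inj₂ (_ , inj₁ a<x)) (inj₁ (_ , x<a))    = <-asym a<x x<a
  Between-asym (inj₂ (_ , inj₂ x<b)) (inj₁ (b<x , _))    = <-asym x<b b<x
  Between-asym (inj₂ (b<a , _))  (inj₂ (a<b , _))        = <-asym a<b b<a

  Between-irreflˡ : ∀ {a x b : Fin n} → Between a x b → a ≢ x
  Between-irreflˡ (inj₁ (a<a , _))        refl = <-irrefl refl a<a
  Between-irreflˡ (inj₂ (_ , inj₁ a<a))   refl = <-irrefl refl a<a
  Between-irreflˡ (inj₂ (b<a , inj₂ a<b)) refl = <-asym a<b b<a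

  Between-irreflʳ : ∀ {a x b : Fin n} → Between a x b → x ≢ b
  Between-irreflʳ (inj₁ (_ , b<b))        refl = <-irrefl refl b<b
  Between-irreflʳ (inj₂ (b<a , inj₁ a<b)) refl = <-asym a<b b<a
  Between-irreflʳ (inj₂ (_ , inj₂ b<b))   refl = <-irrefl refl b<b

  Between-total : ∀ {a x b : Fin n} → a ≢ x → x ≢ b → a ≢ b → Between a x b ⊎ Between b x a
  Between-total {a} {x} {b} a≢x x≢b a≢b
    with <-cmp (toℕ a) (toℕ x) | <-cmp (toℕ x) (toℕ b) | <-cmp (toℕ a) (toℕ b)
  ... | tri≈ _ a≡x _ | _ | _ = ⊥-elim (a≢x (toℕ-injective a≡x))
  ... | _ | tri≈ _ x≡b _ | _ = ⊥-elim (x≢b (toℕ-injective x≡b))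
  ... | _ | _ | tri≈ _ a≡b _ = ⊥-elim (a≢b (toℕ-injective a≡b))
  ... | tri< a<x _ _ | tri< x<b _ _ | _            = inj₁ (inj₁ (a<x , x<b))
  ... | tri< a<x _ _ | tri> _ _ b<x | tri< a<b _ _ = inj₂ (inj₂ (a<b , inj₁ b<x))
  ... | tri< a<x _ _ | tri> _ _ b<x | tri> _ _ b<a = inj₁ (inj₂ (b<a , inj₁ a<x))
  ... | tri> _ _ x<a | tri< x<b _ _ | tri< a<b _ _ = inj₂ (inj₂ (a<b , inj₂ x<a))
  ... | tri> _ _ x<a | tri< x<b _ _ | tri> _ _ b<a = inj₁ (inj₂ (b<a , inj₂ x<b))
  ... | tri> _ _ x<a | tri> _ _ b<x | _            = inj₂ (inj₁ (b<x , x<a))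

  -- Between a b c and Between a c d together say that a b c d are in cyclic order.
  Between-widenʳ : ∀ {a b c d : Fin n} → Between a b c → Between a c d → Between a b d
  Between-widenʳ (inj₁ (a<b , b<c)) (inj₁ (_ , c<d))         = inj₁ (a<b , <-trans b<c c<d)
  Between-widenʳ (inj₁ (a<b , _))   (inj₂ (d<a , _))         = inj₂ (d<a , inj₁ a<b)
  Between-widenʳ (inj₂ (c<a , _))   (inj₁ (a<c , _))         = ⊥-elim (<-asym c<a a<c)
  Between-widenʳ (inj₂ (c<a , _))   (inj₂ (_ , inj₁ a<c))    = ⊥-elim (<-asym c<a a<c)
  Between-widenʳ (inj₂ (_ , inj₁ a<b)) (inj₂ (d<a , inj₂ _)) = inj₂ (d<a , inj₁ a<b)
  Between-widenʳ (inj₂ (_ , inj₂ b<c)) (inj₂ (d<a , inj₂ c<d)) = inj₂ (d<a , inj₂ (<-trans b<c c<d))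

  Between-narrowˡ : ∀ {a b c d : Fin n} → Between a b c → Between a c d → Between b c d
  Between-narrowˡ (inj₁ (_ , b<c))   (inj₁ (_ , c<d))          = inj₁ (b<c , c<d)
  Between-narrowˡ (inj₁ (a<b , b<c)) (inj₂ (d<a , inj₁ _))     = inj₂ (<-trans d<a a<b , inj₁ b<c)
  Between-narrowˡ (inj₁ (a<b , b<c)) (inj₂ (d<a , inj₂ c<d))   =
    ⊥-elim (<-irrefl refl (<-trans (<-trans a<b b<c) (<-trans c<d d<a)))
  Between-narrowˡ (inj₂ (c<a , _))   (inj₁ (a<c , _))          = ⊥-elim (<-asym c<a a<c)
  Between-narrowˡ (inj₂ (c<a , _))   (inj₂ (_ , inj₁ a<c))     = ⊥-elim (<-asym c<a a<c)
  Between-narrowˡ (inj₂ (_ , inj₁ a<b)) (inj₂ (d<a , inj₂ c<d)) = inj₂ (<-trans d<a a<b , inj₂ c<d)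
  Between-narrowˡ (inj₂ (_ , inj₂ b<c)) (inj₂ (_ , inj₂ c<d))   = inj₁ (b<c , c<d)

  Between-widenˡ : ∀ {a b c d : Fin n} → Between a b d → Between b c d → Between a c d
  Between-widenˡ abd bcd = Between-rotate⁻¹ (Between-narrowˡ bcd (Between-rotate abd))

  ClosedArc : Fin n → Fin n → Pred (Fin n) 0ℓ
  ClosedArc a b x = x ≡ a ⊎ x ≡ b ⊎ Between a x b

  closedArc? : (a b : Fin n) → Decidable (ClosedArc a b)
  closedArc? a b = (_≟ᶠ a) ∪? (_≟ᶠ b) ∪? λ x → between? a x b

  closedArcSize : Fin n → Fin n → ℕ
  closedArcSize a b = length (filter (closedArc? a b) (allFin n))

  count-vertex : (a : Fin n) → length (filter (_≟ᶠ a) (allFin n)) ≡ 1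
  count-vertex a = length-filter-≟ _≟ᶠ_ (allFin⁺ n) (∈-allFin a)

  closedArcSize≡2+arcSize : ∀ {a b : Fin n} → a ≢ b → closedArcSize a b ≡ 2 + arcSize a b
  closedArcSize≡2+arcSize {a} {b} a≢b = begin
    closedArcSize a b                                  ≡⟨ length-filter-∪ (_≟ᶠ a) rest? a∉rest (allFin n) ⟩
    length (filter (_≟ᶠ a) (allFin n)) + length (filter rest? (allFin n))
      ≡⟨ cong₂ _+_ (count-vertex a) (length-filter-∪ (_≟ᶠ b) (λ x → between? a x b) b∉arc (allFin n)) ⟩
    1 + (length (filter (_≟ᶠ b) (allFin n)) + arcSize a b) ≡⟨ cong (λ k → 1 + (k + arcSize a b)) (count-vertex b) ⟩
    2 + arcSize a b                                    ∎
    where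
    open ≡-Reasoning
    rest? : Decidable (λ x → x ≡ b ⊎ Between a x b)
    rest? = (_≟ᶠ b) ∪? λ x → between? a x b
    a∉rest : ∀ {x} → x ≡ a → ¬ (x ≡ b ⊎ Between a x b)
    a∉rest refl (inj₁ a≡b) = a≢b a≡b
    a∉rest refl (inj₂ aab) = Between-irreflˡ aab refl
    b∉arc : ∀ {x} → x ≡ b → ¬ Between a x b
    b∉arc refl abb = Between-irreflʳ abb refl

  closedArcs-disjoint : ∀ {a b c d : Fin n} → (∀ {x} → ClosedArc a b x → ¬ ClosedArc c d x) →
    closedArcSize a b + closedArcSize c d ≤ n
  closedArcs-disjoint {a} {b} {c} {d} separated =
    subst (closedArcSize a b + closedArcSize c d ≤_) (length-tabulate id)
      (length-filter-disjoint (closedArc? a b) (closedArc? c d) separated (allFin n))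

  -- For a c d b in cyclic order the closed arcs [c, d] and [b, a] are disjoint,
  -- so their open parts cannot both reach the threshold.
  halving-edges-not-nested : ∀ {a b c d : Fin n} → Between a c b → Between c d b →
    (n ∸ 2) / 2 ≤ arcSize c d → (n ∸ 2) / 2 ≤ arcSize b a → ⊥
  halving-edges-not-nested {a} {b} {c} {d} acb cdb t≤cd t≤ba = <⇒≱ (halving-threshold n) (begin
    (2 + t) + (2 + t)                  ≤⟨ +-mono-≤ (+-monoʳ-≤ 2 t≤cd) (+-monoʳ-≤ 2 t≤ba) ⟩
    (2 + arcSize c d) + (2 + arcSize b a)
      ≡⟨ sym (cong₂ _+_ (closedArcSize≡2+arcSize (Between-irreflˡ cdb)) (closedArcSize≡2+arcSize b≢a)) ⟩
    closedArcSize c d + closedArcSize b a ≤⟨ closedArcs-disjoint separated ⟩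
    n                                  ∎)
    where
    open ≤-Reasoning
    t : ℕ
    t = (n ∸ 2) / 2
    b≢a : b ≢ a
    b≢a refl = Between-asym acb acb
    inside : ∀ {x} → ClosedArc c d x → Between a x b
    inside (inj₁ refl)        = acb
    inside (inj₂ (inj₁ refl)) = Between-widenˡ acb cdb
    inside (inj₂ (inj₂ cxd))  = Between-widenˡ acb (Between-widenʳ cxd cdb)
    outside : ∀ {x} → ClosedArc b a x → ¬ Between a x b
    outside (inj₁ refl)        abb = Between-irreflʳ abb refl
    outside (inj₂ (inj₁ refl)) aab = Between-irreflˡ aab refl
    outside (inj₂ (inj₂ bxa))  axb = Between-asym axb bxa
    separated : ∀ {x} → ClosedArc c d x → ¬ ClosedArc b a x
    separated x∈cd x∈ba = outside x∈ba (inside x∈cd)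

  intersect? : (a b c d : Fin n) → Dec (Intersect a b c d)
  intersect? a b c d =
    (a ≟ᶠ c ⊎-dec a ≟ᶠ d ⊎-dec b ≟ᶠ c ⊎-dec b ≟ᶠ d)
    ⊎-dec ((between? a c b ×-dec between? b d a) ⊎-dec (between? b c a ×-dec between? a d b))

  Cross-sym : ∀ {a b c d : Fin n} → Cross a b c d → Cross c d a b
  Cross-sym {a} {b} {c} {d} (inj₁ (acb , bda)) =
    inj₂ (Between-rotate⁻¹ (Between-widenʳ acb abd) , Between-narrowˡ acb abd)
    where
    abd : Between a b d
    abd = Between-rotate⁻¹ bda
  Cross-sym {a} {b} {c} {d} (inj₂ (bca , adb)) =
    inj₁ (Between-narrowˡ bca bad , Between-rotate⁻¹ (Between-widenʳ bca bad))
    where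
    bad : Between b a d
    bad = Between-rotate⁻¹ adb

  Intersect-sym : ∀ {a b c d : Fin n} → Intersect a b c d → Intersect c d a b
  Intersect-sym (inj₁ (inj₁ a≡c))                 = inj₁ (inj₁ (sym a≡c))
  Intersect-sym (inj₁ (inj₂ (inj₁ a≡d)))          = inj₁ (inj₂ (inj₂ (inj₁ (sym a≡d))))
  Intersect-sym (inj₁ (inj₂ (inj₂ (inj₁ b≡c))))   = inj₁ (inj₂ (inj₁ (sym b≡c)))
  Intersect-sym (inj₁ (inj₂ (inj₂ (inj₂ b≡d))))   = inj₁ (inj₂ (inj₂ (inj₂ (sym b≡d))))
  Intersect-sym (inj₂ cross)                      = inj₂ (Cross-sym cross)

  Side : Fin n → Fin n → Fin n → Set
  Side a b u = Between a u b ⊎ Between b u a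

  SameSide : Fin n → Fin n → Fin n → Fin n → Set
  SameSide a b u v = (Between a u b × Between a v b) ⊎ (Between b u a × Between b v a)

  SameSide-sideˡ : ∀ {a b u v : Fin n} → SameSide a b u v → Side a b u
  SameSide-sideˡ (inj₁ (aub , _)) = inj₁ aub
  SameSide-sideˡ (inj₂ (bua , _)) = inj₂ bua

  SameSide-sideʳ : ∀ {a b u v : Fin n} → SameSide a b u v → Side a b v
  SameSide-sideʳ (inj₁ (_ , avb)) = inj₁ avb
  SameSide-sideʳ (inj₂ (_ , bva)) = inj₂ bva

  SameSide-trans : ∀ {a b u v w : Fin n} → SameSide a b u v → SameSide a b v w → SameSide a b u w
  SameSide-trans (inj₁ (aub , _))   (inj₁ (_ , awb))   = inj₁ (aub , awb)
  SameSide-trans (inj₂ (bua , _))   (inj₂ (_ , bwa))   = inj₂ (bua , bwa)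
  SameSide-trans (inj₁ (_ , avb))   (inj₂ (bva , _))   = ⊥-elim (Between-asym avb bva)
  SameSide-trans (inj₂ (_ , bva))   (inj₁ (avb , _))   = ⊥-elim (Between-asym avb bva)

  ¬Intersect⇒SameSide : ∀ {a b u v : Fin n} → a ≢ b → ¬ Intersect a b u v → SameSide a b u v
  ¬Intersect⇒SameSide {a} {b} {u} {v} a≢b ¬meet with side-u | side-v
    where
    side-u : Side a b u
    side-u = Between-total (λ a≡u → ¬meet (inj₁ (inj₁ a≡u)))
                           (λ u≡b → ¬meet (inj₁ (inj₂ (inj₂ (inj₁ (sym u≡b)))))) a≢b
    side-v : Side a b v
    side-v = Between-total (λ a≡v → ¬meet (inj₁ (inj₂ (inj₁ a≡v))))
                           (λ v≡b → ¬meet (inj₁ (inj₂ (inj₂ (inj₂ (sym v≡b)))))) a≢b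
  ... | inj₁ aub | inj₁ avb = inj₁ (aub , avb)
  ... | inj₂ bua | inj₂ bva = inj₂ (bua , bva)
  ... | inj₁ aub | inj₂ bva = ⊥-elim (¬meet (inj₂ (inj₁ (aub , bva))))
  ... | inj₂ bua | inj₁ avb = ⊥-elim (¬meet (inj₂ (inj₂ (bua , avb))))

  SameSide⇒¬Intersect : ∀ {a b u v : Fin n} → SameSide a b u v → ¬ Intersect a b u v
  SameSide⇒¬Intersect (inj₁ (aub , _))   (inj₁ (inj₁ a≡u))               = Between-irreflˡ aub a≡u
  SameSide⇒¬Intersect (inj₁ (_ , avb))   (inj₁ (inj₂ (inj₁ a≡v)))        = Between-irreflˡ avb a≡v
  SameSide⇒¬Intersect (inj₁ (aub , _))   (inj₁ (inj₂ (inj₂ (inj₁ b≡u)))) = Between-irreflʳ aub (sym b≡u)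
  SameSide⇒¬Intersect (inj₁ (_ , avb))   (inj₁ (inj₂ (inj₂ (inj₂ b≡v)))) = Between-irreflʳ avb (sym b≡v)
  SameSide⇒¬Intersect (inj₂ (bua , _))   (inj₁ (inj₁ a≡u))               = Between-irreflʳ bua (sym a≡u)
  SameSide⇒¬Intersect (inj₂ (_ , bva))   (inj₁ (inj₂ (inj₁ a≡v)))        = Between-irreflʳ bva (sym a≡v)
  SameSide⇒¬Intersect (inj₂ (bua , _))   (inj₁ (inj₂ (inj₂ (inj₁ b≡u)))) = Between-irreflˡ bua b≡u
  SameSide⇒¬Intersect (inj₂ (_ , bva))   (inj₁ (inj₂ (inj₂ (inj₂ b≡v)))) = Between-irreflˡ bva b≡v
  SameSide⇒¬Intersect (inj₁ (_ , avb))   (inj₂ (inj₁ (_ , bva)))         = Between-asym avb bva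
  SameSide⇒¬Intersect (inj₁ (aub , _))   (inj₂ (inj₂ (bua , _)))         = Between-asym aub bua
  SameSide⇒¬Intersect (inj₂ (bua , _))   (inj₂ (inj₁ (aub , _)))         = Between-asym aub bua
  SameSide⇒¬Intersect (inj₂ (_ , bva))   (inj₂ (inj₂ (_ , avb)))         = Between-asym avb bva

  -- No vertex lies strictly between j and j + 1, so the chord a b cannot separate them.
  SameSide-sucMod : ∀ {a b j : Fin n} → Side a b j → Side a b (sucMod j) → SameSide a b j (sucMod j)
  SameSide-sucMod (inj₁ ajb) (inj₁ aj'b) = inj₁ (ajb , aj'b)
  SameSide-sucMod (inj₂ bja) (inj₂ bj'a) = inj₂ (bja , bj'a)
  SameSide-sucMod {j = j} (inj₁ ajb) (inj₂ bj'a) =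
    ⊥-elim (sucMod-adjacent j _ (Between-narrowˡ ajb (Between-rotate⁻¹ bj'a)))
  SameSide-sucMod {j = j} (inj₂ bja) (inj₁ aj'b) =
    ⊥-elim (sucMod-adjacent j _ (Between-narrowˡ bja (Between-rotate⁻¹ aj'b)))

  halving-chord-not-inside : ∀ {a b c d : Fin n} → Between a c b → Between a d b → c ≢ d →
    (n ∸ 2) / 2 ≤ arcSize b a → ¬ IsHalving c d
  halving-chord-not-inside acb adb c≢d t≤ba (t≤cd , t≤dc)
    with Between-total c≢d (Between-irreflʳ adb) (Between-irreflʳ acb)
  ... | inj₁ cdb = halving-edges-not-nested acb cdb t≤cd t≤ba
  ... | inj₂ bdc = halving-edges-not-nested adb (Between-rotate bdc) t≤dc t≤ba

  halving-edges-intersect : ∀ {a b c d : Fin n} → a ≢ b → c ≢ d →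
    IsHalving a b → IsHalving c d → Intersect a b c d
  halving-edges-intersect {a} {b} {c} {d} a≢b c≢d (t≤ab , t≤ba) halving-cd with intersect? a b c d
  ... | yes meet = meet
  ... | no ¬meet with ¬Intersect⇒SameSide a≢b ¬meet
  ...   | inj₁ (acb , adb) = ⊥-elim (halving-chord-not-inside acb adb c≢d t≤ba halving-cd)
  ...   | inj₂ (bca , bda) = ⊥-elim (halving-chord-not-inside bca bda c≢d t≤ab halving-cd)

  pair-sameSide : ∀ {a b i j k : Fin n} → a ≢ b → ¬ Intersect a b i j → ¬ Intersect a b (sucMod j) k →
    SameSide a b i j × SameSide a b j (sucMod j) × SameSide a b (sucMod j) k
  pair-sameSide {a} {b} {i} {j} {k} a≢b ¬meet₁ ¬meet₂ =
    sameˡ , SameSide-sucMod (SameSide-sideʳ sameˡ) (SameSide-sideˡ sameʳ) , sameʳ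
    where
    sameˡ : SameSide a b i j
    sameˡ = ¬Intersect⇒SameSide a≢b ¬meet₁
    sameʳ : SameSide a b (sucMod j) k
    sameʳ = ¬Intersect⇒SameSide a≢b ¬meet₂

  -- Every edge meeting the chord meets the pair, so facts about halving edges transfer to halving pairs.
  record SpannedHalvingEdge (p : HalvingPair n) : Set where
    constructor spanned
    field
      chord         : Edge n
      chord-halving : HalvingEdge chord
      chord-covered : ∀ e → EdgesIntersect chord e → EdgeMeetsPair e p

  OneSideOfPair : Fin n → Fin n → HalvingPair n → Set
  OneSideOfPair a b p =
    SameSide a b (i p) (j p) × SameSide a b (j p) (sucMod (j p)) × SameSide a b (sucMod (j p)) (k p)

  spannedBy : (p : HalvingPair n) (u v : Fin n) → u ≢ v → IsHalving u v →
    (∀ {a b} → OneSideOfPair a b p → SameSide a b u v) → SpannedHalvingEdge p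
  spannedBy p u v u≢v halving-uv sameSide = spanned (edge u v u≢v) halving-uv covered
    where
    covered : ∀ e → Intersect u v (src e) (tgt e) → EdgeMeetsPair e p
    covered (edge a b a≢b) meet with intersect? a b (i p) (j p) | intersect? a b (sucMod (j p)) (k p)
    ... | yes meet₁ | _         = inj₁ meet₁
    ... | no _      | yes meet₂ = inj₂ meet₂
    ... | no ¬meet₁ | no ¬meet₂ =
      ⊥-elim (SameSide⇒¬Intersect (sameSide (pair-sameSide a≢b ¬meet₁ ¬meet₂)) (Intersect-sym meet))

  spannedHalvingEdge : (p : HalvingPair n) → SpannedHalvingEdge p
  spannedHalvingEdge p with halving p
  ... | inj₁ halving-ij' =
    spannedBy p _ _ (λ i≡j' → disjoint p (inj₁ (inj₁ i≡j'))) halving-ij'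
      λ (sij , sjj' , _) → SameSide-trans sij sjj'
  ... | inj₂ (inj₁ halving-ik) =
    spannedBy p _ _ (λ i≡k → disjoint p (inj₁ (inj₂ (inj₁ i≡k)))) halving-ik
      λ (sij , sjj' , sj'k) → SameSide-trans sij (SameSide-trans sjj' sj'k)
  ... | inj₂ (inj₂ halving-jk) =
    spannedBy p _ _ (λ j≡k → disjoint p (inj₁ (inj₂ (inj₂ (inj₂ j≡k))))) halving-jk
      λ (_ , sjj' , sj'k) → SameSide-trans sjj' sj'k

  halving-edge-meets-pair : (e : Edge n) (p : HalvingPair n) → HalvingEdge e → EdgeMeetsPair e p
  halving-edge-meets-pair e p halving-e = chord-covered e
    (halving-edges-intersect (distinct chord) (distinct e) chord-halving halving-e)
    where open SpannedHalvingEdge (spannedHalvingEdge p)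

  halving-pairs-intersect : (p q : HalvingPair n) → PairsIntersect p q
  halving-pairs-intersect p q =
    Sum.map (chord-covered (firstEdge p)) (chord-covered (secondEdge p))
      (halving-edge-meets-pair chord p chord-halving)
    where open SpannedHalvingEdge (spannedHalvingEdge q)

lemma1 : (n : ℕ) →
    ((e f : Edge n) → HalvingEdge e → HalvingEdge f → EdgesIntersect e f)
    × ((e : Edge n) (p : HalvingPair n) → HalvingEdge e → EdgeMeetsPair e p)
    × ((p q : HalvingPair n) → PairsIntersect p q)
lemma1 n =
    (λ e f → halving-edges-intersect (distinct e) (distinct f))
  , halving-edge-meets-pair
  , halving-pairs-intersect
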